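{- Let $\rhd$ be a system of ideals for an ordered monoid $G$, and let $S$ be the meet-semilattice generated by the single-conclusion entailment relation $\rhd$, with natural order-preserving map $G\to S$. Then there is a unique monoid law on $S$ which is compatible with its semilattice structure (i.e. $x+(y\wedge z)=(x+y)\wedge(x+z)$) and such that the natural map $G\to S$ is a monoid morphism.
   Context: Monoids are commutative. An ordered monoid is a commutative monoid $(G,+,0)$ with a partial order $\le_G$ such that $x\le_G y$ implies $x+z\le_G y+z$. A meet-semilattice here is a set with an idempotent, commutative, associative law $\wedge$ (no greatest element required). $\mathrm{P}_{\mathrm{fe}}^*(G)$ is the set of nonempty finite subsets of $G$; $a$ stands for $\{a\}$, $A,A'$ for $A\cup A'$, $x+A=\{x+a:a\in A\}$. A single-conclusion entailment relation on $G$ is a relation $\rhd$ between $\mathrm{P}_{\mathrm{fe}}^*(G)$ and $G$ such that $a\rhd a$; $A\rhd b\Rightarrow A,A'\rhd b$; ($A\rhd c$ and $A,c\rhd b$) $\Rightarrow A\rhd b$. It is a system of ideals for the ordered monoid $G$ if moreover $a\le_G b\Rightarrow a\rhd b$ and $A\rhd b\Rightarrow x+A\rhd x+b$ for all $x\in G$. The meet-semilattice generated by $\rhd$ is the meet-semilattice presented by generators the elements of $G$ and relations $\bigwedge A\le b$ whenever $A\rhd b$; equivalently it is the quotient of $\mathrm{P}_{\mathrm{fe}}^*(G)$ by the preorder $A\le_\rhd B$ iff $A\rhd b$ for all $b\in B$, with meet induced by union. -}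

module Defs where

open import Level using (Level; _⊔_; suc)
open import Data.Product using (_×_; Σ; _,_)
open import Data.List.NonEmpty using (List⁺; [_]; _∷⁺_; _⁺++⁺_; toList)
import Data.List.NonEmpty as L⁺
open import Relation.Binary.Structures using (IsPartialOrder)
open import Algebra.Bundles using (CommutativeMonoid)
open import Algebra.Structures using (IsCommutativeMonoid)
import Data.List.Membership.Setoid as Mem

record OrderedMonoid (c ℓ₁ ℓ₂ : Level) : Set (suc (c ⊔ ℓ₁ ⊔ ℓ₂)) where
  field
    commutativeMonoid : CommutativeMonoid c ℓ₁
  open CommutativeMonoid commutativeMonoid public
  infix 4 _≤_
  field
    _≤_            : Carrier → Carrier → Set ℓ₂
    isPartialOrder : IsPartialOrder _≈_ _≤_
    ≤-compat       : ∀ {x y} z → x ≤ y → (x ∙ z) ≤ (y ∙ z)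

module _ {c ℓ₁ ℓ₂ : Level} (G : OrderedMonoid c ℓ₁ ℓ₂) where
  open OrderedMonoid G
  open Mem setoid using (_∈_)

  -- Nonempty finite subsets of G are represented by nonempty lists;
  -- membership is up to ≈.  A ⊆ B means every element of A lies in B.
  _⊆_ : List⁺ Carrier → List⁺ Carrier → Set (c ⊔ ℓ₁)
  A ⊆ B = ∀ {x} → x ∈ toList A → x ∈ toList B

  _+ˡ_ : Carrier → List⁺ Carrier → List⁺ Carrier
  x +ˡ A = L⁺.map (x ∙_) A

  -- Weakening "A ▷ b ⇒ A,A' ▷ b" is stated as monotonicity along ⊆,
  -- which (since lists represent finite sets) is the same as the set
  -- version: it makes ▷ invariant under reordering/duplication.
  record SystemOfIdeals (r : Level) : Set (c ⊔ ℓ₁ ⊔ ℓ₂ ⊔ suc r) where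
    infix 4 _▷_
    field
      _▷_   : List⁺ Carrier → Carrier → Set r
      refl▷ : ∀ a → [ a ] ▷ a
      mono▷ : ∀ {A A' b} → A ⊆ A' → A ▷ b → A' ▷ b
      cut▷  : ∀ {A b c} → A ▷ c → (c ∷⁺ A) ▷ b → A ▷ b
      ord▷  : ∀ {a b} → a ≤ b → [ a ] ▷ b
      trans▷ : ∀ {A b} x → A ▷ b → (x +ˡ A) ▷ (x ∙ b)

  module SemilatticeOf {r : Level} (⊳ : SystemOfIdeals r) where
    open SystemOfIdeals ⊳

    -- The meet-semilattice S generated by ▷: elements are nonempty finite
    -- subsets (carrier S below), with preorder A ≤▷ B iff A ▷ b for all
    -- b ∈ B; S is the quotient by the induced equivalence ≈S (kept as a
    -- setoid), and the meet is induced by union.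
    S : Set c
    S = List⁺ Carrier

    _≤S_ : S → S → Set (c ⊔ ℓ₁ ⊔ r)
    A ≤S B = ∀ {b} → b ∈ toList B → A ▷ b

    _≈S_ : S → S → Set (c ⊔ ℓ₁ ⊔ r)
    A ≈S B = (A ≤S B) × (B ≤S A)

    _∧S_ : S → S → S
    A ∧S B = A ⁺++⁺ B

    η : Carrier → S
    η a = [ a ]

    -- A monoid law (⊕, e) on S (commutative, as all monoids here, and
    -- well defined on the quotient, i.e. respecting ≈S), compatible with
    -- the meet, and making η a monoid morphism.
    record GoodLaw (_⊕_ : S → S → S) (e : S) : Set (c ⊔ ℓ₁ ⊔ r) where
      field
        isCommutativeMonoid : IsCommutativeMonoid _≈S_ _⊕_ e
        distrib-∧ : ∀ x y z → (x ⊕ (y ∧S z)) ≈S ((x ⊕ y) ∧S (x ⊕ z))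
        η-hom     : ∀ a b → η (a ∙ b) ≈S (η a ⊕ η b)
        η-unit    : η ε ≈S e

-- Represent an element of S by a finite set A and put A ⊕ B = {a + b | a ∈ A, b ∈ B}.
-- Translation invariance of ▷ (A ▷ b ⇒ x + A ▷ x + b) is exactly what makes ⊕
-- monotone, hence well defined on S; the monoid laws and distributivity over ∧ hold
-- already at the level of sets.  Uniqueness: every element of S is a finite meet of
-- generators, so a law distributing over ∧ is determined by its values on
-- generators, and those are fixed by the requirement that G → S be a morphism.
module Submission where

open import Defs
open import Level using (Level)
open import Function using (_∘_)
open import Data.Product using (Σ; _×_; _,_; proj₁)
open import Data.Sum using (inj₁; inj₂)
open import Data.List as List using (List; []; _∷_; _++_; cartesianProductWith)
open import Data.List.NonEmpty using ([_]; _∷_; _++⁺_; toList)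
open import Data.List.Relation.Unary.Any using (here; there)
import Data.List.Membership.Setoid as Membership
import Data.List.Membership.Setoid.Properties as MembershipP
open import Algebra.Structures using (IsCommutativeMonoid)
open import Relation.Binary.Structures using (IsEquivalence; IsPartialOrder)
open import Relation.Binary.Bundles using (Setoid)
import Relation.Binary.PropositionalEquality as ≡
open ≡ using (_≡_)
import Relation.Binary.Reasoning.Setoid as SetoidReasoning

module _ {c ℓ₁ ℓ₂ r : Level} (G : OrderedMonoid c ℓ₁ ℓ₂) (⊳ : SystemOfIdeals G r) where
  open OrderedMonoid G
  open SystemOfIdeals ⊳
  open SemilatticeOf G ⊳
  open Membership setoid using (_∈_)
  open MembershipP using (∈-resp-≈; ∈-++⁺ˡ; ∈-++⁺ʳ; ∈-++⁻)
  private module ≤ = IsPartialOrder isPartialOrder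

  ∈⇒▷ : ∀ {A b} → b ∈ toList A → A ▷ b
  ∈⇒▷ {b = b} b∈A = mono▷ (λ { (here x≈b) → ∈-resp-≈ setoid (sym x≈b) b∈A ; (there ()) }) (refl▷ b)

  ▷-resp-≈ : ∀ {A b b'} → b ≈ b' → A ▷ b → A ▷ b'
  ▷-resp-≈ b≈b' A▷b = cut▷ A▷b (mono▷ (λ { (here x≈b) → here x≈b ; (there ()) }) (ord▷ (≤.reflexive b≈b')))

  toList-++⁺ : ∀ (L : List Carrier) A → toList (L ++⁺ A) ≡ L ++ toList A
  toList-++⁺ []      A = ≡.refl
  toList-++⁺ (x ∷ L) A = ≡.cong (x ∷_) (toList-++⁺ L A)

  -- Cutting the hypotheses L one at a time, each is entailed by A, which stays in context.
  cut-all : ∀ L {A b} → (∀ {x} → x ∈ L → A ▷ x) → (L ++⁺ A) ▷ b → A ▷ b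
  cut-all []      A▷L  L,A▷b = L,A▷b
  cut-all (x ∷ L) {A} A▷L L,A▷b =
    cut-all L (A▷L ∘ there) (cut▷ (mono▷ ⊆L,A (A▷L (here refl))) L,A▷b)
    where
    ⊆L,A : ∀ {y} → y ∈ toList A → y ∈ toList (L ++⁺ A)
    ⊆L,A {y} y∈A rewrite toList-++⁺ L A = ∈-++⁺ʳ setoid L y∈A

  cut-≤S : ∀ {A B b} → A ≤S B → B ▷ b → A ▷ b
  cut-≤S {A} {B} A≤B B▷b = cut-all (toList B) A≤B (mono▷ ⊆B,A B▷b)
    where
    ⊆B,A : ∀ {y} → y ∈ toList B → y ∈ toList (toList B ++⁺ A)
    ⊆B,A {y} y∈B rewrite toList-++⁺ (toList B) A = ∈-++⁺ˡ setoid y∈B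

  ≤S-refl : ∀ {A} → A ≤S A
  ≤S-refl = ∈⇒▷

  ≤S-trans : ∀ {A B C} → A ≤S B → B ≤S C → A ≤S C
  ≤S-trans A≤B B≤C c∈C = cut-≤S A≤B (B≤C c∈C)

  ⊇⇒≤S : ∀ {A B} → (∀ {x} → x ∈ toList B → x ∈ toList A) → A ≤S B
  ⊇⇒≤S B⊆A = ∈⇒▷ ∘ B⊆A

  ≈S-isEquivalence : IsEquivalence _≈S_
  ≈S-isEquivalence = record
    { refl  = ≤S-refl , ≤S-refl
    ; sym   = λ (A≤B , B≤A) → B≤A , A≤B
    ; trans = λ (A≤B , B≤A) (B≤C , C≤B) → ≤S-trans A≤B B≤C , ≤S-trans C≤B B≤A
    }

  S-setoid : Setoid _ _
  S-setoid = record { isEquivalence = ≈S-isEquivalence }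

  private module ≈S = IsEquivalence ≈S-isEquivalence

  ∧S-mono : ∀ {A A' B B'} → A ≤S A' → B ≤S B' → (A ∧S B) ≤S (A' ∧S B')
  ∧S-mono {A} {A'} A≤A' B≤B' x∈A'∧B' with ∈-++⁻ setoid (toList A') x∈A'∧B'
  ... | inj₁ x∈A' = mono▷ (∈-++⁺ˡ setoid) (A≤A' x∈A')
  ... | inj₂ x∈B' = mono▷ (∈-++⁺ʳ setoid (toList A)) (B≤B' x∈B')

  ∧S-cong : ∀ {A A' B B'} → A ≈S A' → B ≈S B' → (A ∧S B) ≈S (A' ∧S B')
  ∧S-cong (A≤A' , A'≤A) (B≤B' , B'≤B) = ∧S-mono A≤A' B≤B' , ∧S-mono A'≤A B'≤B

  module _ {_⊕₁_ _⊕₂_ : S → S → S} {e₁ e₂ : S}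
           (law₁ : GoodLaw _⊕₁_ e₁) (law₂ : GoodLaw _⊕₂_ e₂) where
    open SetoidReasoning S-setoid
    private
      module L₁ = GoodLaw law₁
      module L₂ = GoodLaw law₂
      module M₁ = IsCommutativeMonoid L₁.isCommutativeMonoid
      module M₂ = IsCommutativeMonoid L₂.isCommutativeMonoid

    goodLaws-agree-η : ∀ a B → (η a ⊕₁ B) ≈S (η a ⊕₂ B)
    goodLaws-agree-η a (b ∷ B) = agree b B
      where
      agree : ∀ b B → (η a ⊕₁ (b ∷ B)) ≈S (η a ⊕₂ (b ∷ B))
      agree b []       = ≈S.trans (≈S.sym (L₁.η-hom a b)) (L₂.η-hom a b)
      agree b (b' ∷ B) = begin
        η a ⊕₁ (η b ∧S (b' ∷ B))            ≈⟨ L₁.distrib-∧ (η a) (η b) (b' ∷ B) ⟩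
        (η a ⊕₁ η b) ∧S (η a ⊕₁ (b' ∷ B))   ≈⟨ ∧S-cong (agree b []) (agree b' B) ⟩
        (η a ⊕₂ η b) ∧S (η a ⊕₂ (b' ∷ B))   ≈⟨ L₂.distrib-∧ (η a) (η b) (b' ∷ B) ⟨
        η a ⊕₂ (η b ∧S (b' ∷ B))            ∎

    goodLaws-agree : ∀ A B → (A ⊕₁ B) ≈S (A ⊕₂ B)
    goodLaws-agree (a ∷ A) B = agree a A
      where
      agree : ∀ a A → ((a ∷ A) ⊕₁ B) ≈S ((a ∷ A) ⊕₂ B)
      agree a []       = goodLaws-agree-η a B
      agree a (a' ∷ A) = begin
        (η a ∧S (a' ∷ A)) ⊕₁ B             ≈⟨ M₁.comm _ B ⟩
        B ⊕₁ (η a ∧S (a' ∷ A))             ≈⟨ L₁.distrib-∧ B (η a) (a' ∷ A) ⟩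
        (B ⊕₁ η a) ∧S (B ⊕₁ (a' ∷ A))      ≈⟨ ∧S-cong (M₁.comm B (η a)) (M₁.comm B (a' ∷ A)) ⟩
        (η a ⊕₁ B) ∧S ((a' ∷ A) ⊕₁ B)      ≈⟨ ∧S-cong (goodLaws-agree-η a B) (agree a' A) ⟩
        (η a ⊕₂ B) ∧S ((a' ∷ A) ⊕₂ B)      ≈⟨ ∧S-cong (M₂.comm (η a) B) (M₂.comm (a' ∷ A) B) ⟩
        (B ⊕₂ η a) ∧S (B ⊕₂ (a' ∷ A))      ≈⟨ L₂.distrib-∧ B (η a) (a' ∷ A) ⟨
        B ⊕₂ (η a ∧S (a' ∷ A))             ≈⟨ M₂.comm B _ ⟩
        (η a ∧S (a' ∷ A)) ⊕₂ B             ∎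

  -- Written so that toList (A ⊕ B) is definitionally cartesianProductWith _∙_ (toList A) (toList B).
  _⊕_ : S → S → S
  (a ∷ A) ⊕ (b ∷ B) = (a ∙ b) ∷ (List.map (a ∙_) B ++ cartesianProductWith _∙_ A (b ∷ B))

  ∈-⊕⁺ : ∀ {A B a b x} → a ∈ toList A → b ∈ toList B → x ≈ a ∙ b → x ∈ toList (A ⊕ B)
  ∈-⊕⁺ {a ∷ A} {b ∷ B} a∈A b∈B x≈ab =
    ∈-resp-≈ setoid (sym x≈ab) (MembershipP.∈-cartesianProductWith⁺ setoid setoid setoid ∙-cong a∈A b∈B)

  ∈-⊕⁻ : ∀ {A B x} → x ∈ toList (A ⊕ B) →
         Σ Carrier λ a → Σ Carrier λ b → a ∈ toList A × b ∈ toList B × x ≈ a ∙ b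
  ∈-⊕⁻ {a ∷ A} {b ∷ B} = MembershipP.∈-cartesianProductWith⁻ setoid setoid setoid _∙_ (a ∷ A) (b ∷ B)

  ⊕-comm : ∀ A B → (A ⊕ B) ≈S (B ⊕ A)
  ⊕-comm A B = ⊇⇒≤S (swap B A) , ⊇⇒≤S (swap A B)
    where
    swap : ∀ X Y {x} → x ∈ toList (X ⊕ Y) → x ∈ toList (Y ⊕ X)
    swap X Y x∈XY with ∈-⊕⁻ {X} x∈XY
    ... | a , b , a∈X , b∈Y , x≈ab = ∈-⊕⁺ {Y} b∈Y a∈X (trans x≈ab (comm a b))

  ⊕-assoc : ∀ A B C → ((A ⊕ B) ⊕ C) ≈S (A ⊕ (B ⊕ C))
  ⊕-assoc A B C = ⊇⇒≤S right⊆left , ⊇⇒≤S left⊆right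
    where
    left⊆right : ∀ {x} → x ∈ toList ((A ⊕ B) ⊕ C) → x ∈ toList (A ⊕ (B ⊕ C))
    left⊆right x∈ with ∈-⊕⁻ {A ⊕ B} x∈
    ... | y , c , y∈AB , c∈C , x≈yc with ∈-⊕⁻ {A} y∈AB
    ... | a , b , a∈A , b∈B , y≈ab =
      ∈-⊕⁺ {A} a∈A (∈-⊕⁺ {B} b∈B c∈C refl) (trans x≈yc (trans (∙-cong y≈ab refl) (assoc a b c)))
    right⊆left : ∀ {x} → x ∈ toList (A ⊕ (B ⊕ C)) → x ∈ toList ((A ⊕ B) ⊕ C)
    right⊆left x∈ with ∈-⊕⁻ {A} x∈
    ... | a , y , a∈A , y∈BC , x≈ay with ∈-⊕⁻ {B} y∈BC
    ... | b , c , b∈B , c∈C , y≈bc =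
      ∈-⊕⁺ {A ⊕ B} (∈-⊕⁺ {A} a∈A b∈B refl) c∈C (trans x≈ay (trans (∙-cong refl y≈bc) (sym (assoc a b c))))

  ⊕-identityˡ : ∀ A → (η ε ⊕ A) ≈S A
  ⊕-identityˡ A = ⊇⇒≤S A⊆εA , ⊇⇒≤S εA⊆A
    where
    εA⊆A : ∀ {x} → x ∈ toList (η ε ⊕ A) → x ∈ toList A
    εA⊆A x∈ with ∈-⊕⁻ {η ε} x∈
    ... | _ , b , here a≈ε , b∈A , x≈ab =
      ∈-resp-≈ setoid (sym (trans x≈ab (trans (∙-cong a≈ε refl) (identityˡ b)))) b∈A
    A⊆εA : ∀ {x} → x ∈ toList A → x ∈ toList (η ε ⊕ A)
    A⊆εA x∈A = ∈-⊕⁺ {η ε} (here refl) x∈A (sym (identityˡ _))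

  ⊕-distribˡ-∧S : ∀ A B C → (A ⊕ (B ∧S C)) ≈S ((A ⊕ B) ∧S (A ⊕ C))
  ⊕-distribˡ-∧S A B C = ⊇⇒≤S right⊆left , ⊇⇒≤S left⊆right
    where
    left⊆right : ∀ {x} → x ∈ toList (A ⊕ (B ∧S C)) → x ∈ toList ((A ⊕ B) ∧S (A ⊕ C))
    left⊆right x∈ with ∈-⊕⁻ {A} x∈
    ... | a , b , a∈A , b∈B∧C , x≈ab with ∈-++⁻ setoid (toList B) b∈B∧C
    ... | inj₁ b∈B = ∈-++⁺ˡ setoid (∈-⊕⁺ {A} a∈A b∈B x≈ab)
    ... | inj₂ b∈C = ∈-++⁺ʳ setoid (toList (A ⊕ B)) (∈-⊕⁺ {A} a∈A b∈C x≈ab)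
    right⊆left : ∀ {x} → x ∈ toList ((A ⊕ B) ∧S (A ⊕ C)) → x ∈ toList (A ⊕ (B ∧S C))
    right⊆left x∈ with ∈-++⁻ setoid (toList (A ⊕ B)) x∈
    ... | inj₁ x∈AB with ∈-⊕⁻ {A} x∈AB
    ...   | a , b , a∈A , b∈B , x≈ab = ∈-⊕⁺ {A} a∈A (∈-++⁺ˡ setoid b∈B) x≈ab
    right⊆left x∈ | inj₂ x∈AC with ∈-⊕⁻ {A} x∈AC
    ...   | a , b , a∈A , b∈C , x≈ab = ∈-⊕⁺ {A} a∈A (∈-++⁺ʳ setoid (toList B) b∈C) x≈ab

  -- A ▷ a' translates to b + A ▷ b + a', and b + A ⊆ A ⊕ B whenever b ∈ B.
  ⊕-monoˡ-≤S : ∀ {A A'} B → A ≤S A' → (A ⊕ B) ≤S (A' ⊕ B)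
  ⊕-monoˡ-≤S {A} {A'} B A≤A' x∈A'B with ∈-⊕⁻ {A'} x∈A'B
  ... | a' , b , a'∈A' , b∈B , x≈a'b =
    ▷-resp-≈ (trans (comm b a') (sym x≈a'b)) (mono▷ b+A⊆AB (trans▷ b (A≤A' a'∈A')))
    where
    b+A⊆AB : ∀ {y} → y ∈ toList (_+ˡ_ G b A) → y ∈ toList (A ⊕ B)
    b+A⊆AB y∈b+A with MembershipP.∈-map⁻ setoid setoid y∈b+A
    ... | a , a∈A , y≈ba = ∈-⊕⁺ {A} a∈A b∈B (trans y≈ba (comm b a))

  ⊕-mono-≤S : ∀ {A A' B B'} → A ≤S A' → B ≤S B' → (A ⊕ B) ≤S (A' ⊕ B')
  ⊕-mono-≤S {A} {A'} {B} {B'} A≤A' B≤B' =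
    ≤S-trans (⊕-monoˡ-≤S B A≤A') (≤S-trans (proj₁ (⊕-comm A' B))
      (≤S-trans (⊕-monoˡ-≤S A' B≤B') (proj₁ (⊕-comm B' A'))))

  ⊕-cong : ∀ {A A' B B'} → A ≈S A' → B ≈S B' → (A ⊕ B) ≈S (A' ⊕ B')
  ⊕-cong (A≤A' , A'≤A) (B≤B' , B'≤B) = ⊕-mono-≤S A≤A' B≤B' , ⊕-mono-≤S A'≤A B'≤B

  ⊕-goodLaw : GoodLaw _⊕_ (η ε)
  ⊕-goodLaw = record
    { isCommutativeMonoid = record
      { isMonoid = record
        { isSemigroup = record
          { isMagma = record { isEquivalence = ≈S-isEquivalence ; ∙-cong = ⊕-cong }
          ; assoc   = ⊕-assoc
          }
        ; identity = ⊕-identityˡ , λ A → ≈S.trans (⊕-comm A (η ε)) (⊕-identityˡ A)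
        }
      ; comm = ⊕-comm
      }
    ; distrib-∧ = ⊕-distribˡ-∧S
    ; η-hom     = λ _ _ → ≈S.refl
    ; η-unit    = ≈S.refl
    }

theorem1p10 : ∀ {c ℓ₁ ℓ₂ r : Level} (G : OrderedMonoid c ℓ₁ ℓ₂)
    (⊳ : SystemOfIdeals G r) →
    let open SemilatticeOf G ⊳ in
    Σ (S → S → S) (λ _⊕_ → Σ S (λ e →
      GoodLaw _⊕_ e ×
      (∀ (_⊕'_ : S → S → S) (e' : S) → GoodLaw _⊕'_ e' →
        (∀ x y → (x ⊕ y) ≈S (x ⊕' y)) × (e ≈S e'))))
theorem1p10 G ⊳ =
  _⊕_ G ⊳ , η ε , ⊕-goodLaw G ⊳ ,
  λ _ _ law → goodLaws-agree G ⊳ (⊕-goodLaw G ⊳) law , GoodLaw.η-unit law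
  where
  open OrderedMonoid G using (ε)
  open SemilatticeOf G ⊳ using (η; module GoodLaw)
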